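{- Let $d\geq 2$ and let $V$ be a finite set with at least $d+2$ elements. Let $\mathcal{Y}(V)$ be the set of all $(V,\mathcal{H})\in\mathrm{BPav}(d)$ having no restriction isomorphic to the uniform matroid $U_{d,d+2}$. If $(V,\mathcal{H}_1),(V,\mathcal{H}_2)\in\mathcal{Y}(V)$, then $(V,\mathcal{H}_1\cup\mathcal{H}_2)\in\mathcal{Y}(V)$.
   Context: A (finite) simplicial complex is a pair $S=(V,\mathcal{H})$ where $V$ is a finite nonempty set and $\mathcal{H}\subseteq 2^V$ contains all singletons and is closed under taking subsets. Its dimension is $\max\{|I|:I\in\mathcal{H}\}-1$. $P_n(V)$ (resp. $P_{\leq n}(V)$) is the set of subsets of size exactly (resp. at most) $n$. $S$ is paving if $P_{\dim S}(V)\subseteq\mathcal{H}$. $S$ is boolean representable if there is a boolean matrix $M$ with columns indexed by $V$ such that $\mathcal{H}$ is exactly the set of $X\subseteq V$ for which some square submatrix with column set $X$ is congruent (by permuting rows and columns) to a lower unitriangular boolean matrix. $\mathrm{BPav}(d)$ is the class of paving boolean representable simplicial complexes of dimension $d$. For nonempty $W\subseteq V$, the restriction is $S|_W=(W,\mathcal{H}\cap 2^W)$. Two complexes $(V,\mathcal{H}),(V',\mathcal{H}')$ are isomorphic if there is a bijection $\varphi:V\to V'$ with $X\in\mathcal{H}\iff X\varphi\in\mathcal{H}'$. The uniform matroid $U_{k,n}$ is $(W,P_{\leq k}(W))$ with $|W|=n$. -}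

module Defs where

open import Data.Nat using (ℕ; zero; suc; _≤_; _<_; _+_)
open import Data.Bool using (Bool; true; false; _∧_; _∨_)
import Data.Fin
open import Data.Fin using (Fin; zero; suc; _≟_)
open import Data.Fin.Subset using (Subset; _⊆_; ⁅_⁆; ∣_∣; _∈_)
open import Data.Vec using (lookup; tabulate)
open import Data.Product using (Σ; _×_; ∃; ∃-syntax)
open import Function.Bundles using (_⇔_)
open import Function.Definitions using (Injective)
open import Relation.Binary.PropositionalEquality using (_≡_)
import Data.Empty
open import Relation.Nullary.Decidable using (⌊_⌋)

Family : ℕ → Set
Family n = Subset n → Bool

infix 4 _∈H_
_∈H_ : {n : ℕ} → Subset n → Family n → Set
X ∈H H = H X ≡ true

_∪H_ : {n : ℕ} → Family n → Family n → Family n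
(H₁ ∪H H₂) X = H₁ X ∨ H₂ X

anyFin : {k : ℕ} → (Fin k → Bool) → Bool
anyFin {zero} f = false
anyFin {suc k} f = f zero ∨ anyFin (λ i → f (suc i))

image : {k n : ℕ} → (Fin k → Fin n) → Subset k → Subset n
image {k} φ X = tabulate (λ y → anyFin (λ x → lookup X x ∧ ⌊ φ x ≟ y ⌋))

Enumerates : {k n : ℕ} → (Fin k → Fin n) → Subset n → Set
Enumerates {k} {n} c X = Injective _≡_ _≡_ c × (∀ (y : Fin n) → (y ∈ X ⇔ (∃[ x ] c x ≡ y)))

-- simplicial complex on V = Fin n (V nonempty is imposed separately)
IsSimplicialComplex : {n : ℕ} → Family n → Set
IsSimplicialComplex {n} H =
  (∀ (i : Fin n) → ⁅ i ⁆ ∈H H) ×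
  (∀ (X Y : Subset n) → Y ⊆ X → X ∈H H → Y ∈H H)

-- dimension d: max { |I| : I ∈ H } - 1 = d
HasDimension : {n : ℕ} → ℕ → Family n → Set
HasDimension {n} d H =
  (∃[ I ] (I ∈H H × ∣ I ∣ ≡ suc d)) × (∀ (I : Subset n) → I ∈H H → ∣ I ∣ ≤ suc d)

IsPaving : {n : ℕ} → ℕ → Family n → Set
IsPaving {n} d H = ∀ (X : Subset n) → ∣ X ∣ ≡ d → X ∈H H

BMatrix : ℕ → ℕ → Set
BMatrix m n = Fin m → Fin n → Bool

-- some square submatrix of M with column set X is congruent (permuting rows
-- and columns) to a lower unitriangular matrix: rows r i and columns c i
-- (c enumerating X) with 1 on the diagonal and 0 strictly above it.
HasLowerUnitriangularSubmatrix : {m n : ℕ} → BMatrix m n → Subset n → Set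
HasLowerUnitriangularSubmatrix {m} {n} M X =
  Σ ℕ λ k → Σ (Fin k → Fin m) λ r → Σ (Fin k → Fin n) λ c →
    Injective _≡_ _≡_ r × Enumerates c X ×
    (∀ (i : Fin k) → M (r i) (c i) ≡ true) ×
    (∀ (i j : Fin k) → Data.Fin._<_ i j → M (r i) (c j) ≡ false)

IsBooleanRepresentable : {n : ℕ} → Family n → Set
IsBooleanRepresentable {n} H =
  Σ ℕ λ m → Σ (BMatrix m n) λ M →
    ∀ (X : Subset n) → ((X ∈H H) ⇔ HasLowerUnitriangularSubmatrix M X)

InBPav : {n : ℕ} → ℕ → Family n → Set
InBPav {n} d H =
  IsSimplicialComplex H × HasDimension d H × IsPaving d H × IsBooleanRepresentable H

-- The restriction (W, H ∩ 2^W) is isomorphic to (Fin k, P_{≤ j}(Fin k)) = U_{j,k}: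
-- a bijection φ : Fin k → W such that for all X ⊆ Fin k,
-- X ∈ P_{≤ j}(Fin k)  ⇔  Xφ ∈ H ∩ 2^W  (images Xφ are exactly the subsets of W).
RestrictionIsoUniform : {n : ℕ} → Family n → Subset n → (j k : ℕ) → Set
RestrictionIsoUniform {n} H W j k =
  Σ (Fin k → Fin n) λ φ → Enumerates φ W ×
    (∀ (X : Subset k) → (∣ X ∣ ≤ j ⇔ (image φ X ∈H H)))

HasUniformRestriction : {n : ℕ} → Family n → (j k : ℕ) → Set
HasUniformRestriction {n} H j k =
  Σ (Subset n) λ W → (∃[ w ] w ∈ W) × RestrictionIsoUniform H W j k

InY : {n : ℕ} → ℕ → Family n → Set
InY d H = InBPav d H × (HasUniformRestriction H d (d + 2) → Data.Empty.⊥)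

-- Let H = H₁ ∪ H₂. A down-closed family containing ∅ is represented by the matrix whose rows
-- are the complements of all its flats as soon as every nonempty face X has an element x and a
-- flat F with X - x ⊆ F and x ∉ F. Paving makes every set of fewer than d points a flat of H,
-- which settles the faces of size ≤ d. A face X of size d + 1, say of H₁, gets from a
-- representation of H₁ a flat Z of H₁ with X - x ⊆ Z and x ∉ Z; moreover ∣Z∣ ≤ d + 1, since
-- d + 2 points of a flat missing some q span a restriction isomorphic to U_{d,d+2}. If Z ∈ H₂,
-- then X - x is itself a flat of H: each J ∪ {p} with p ∈ Z is a face of H₂ below Z. Otherwise Z
-- is a flat of H: a face of H₂ inside Z that is not in H₁ has at least d + 1 ≥ ∣Z∣ points, so it
-- would be Z. Finally, since all sets of size ≤ d lie in H₁, a restriction of H isomorphic to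
-- U_{d,d+2} would also be one of H₁.

module Submission where

open import Defs
open import Data.Bool using (Bool; true; false; not; _∧_; _∨_)
open import Data.Bool.Properties using (not-involutive; ¬-not) renaming (_≟_ to _≟ᵇ_)
open import Data.Empty using (⊥-elim)
open import Data.Fin using (Fin; zero; suc; _≟_; _<_; inject≤; fromℕ<; finToFun; funToFin)
open import Data.Fin.Properties using (¬Fin0; injective⇒≤; inject≤-injective; suc-injective; any?; 2↔Bool; finToFun-funToFin)
open import Data.Fin.Subset using (Subset; outside; inside; _⊆_; _⊂_; _∈_; _∉_; _∪_; _─_; _-_; ⁅_⁆; ⊤; ⊥; ∣_∣; Nonempty)
open import Data.Fin.Subset.Induction using (⊂-wellFounded)
open import Data.Fin.Subset.Properties
open import Data.Nat using (ℕ; zero; suc; _+_; _^_; _≤_; z≤n; s≤s; _≤?_)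
open import Data.Nat.Properties using (module ≤-Reasoning; ≤-trans; ≤-reflexive; ≤-antisym; ≤-pred; ≰⇒>; <⇒≱; +-suc; +-comm; m≤n+m; m≤m+n; m<m+n)
open import Data.Product using (Σ; _×_; _,_; proj₁; proj₂; ∃-syntax; map; map₂)
open import Data.Sum using (_⊎_; inj₁; inj₂; [_,_])
open import Data.Sum.Algebra using (⊎-comm)
open import Data.Vec using ([]; _∷_; lookup; tabulate; here; there)
open import Data.Vec.Functional using () renaming (_∷_ to _∷ᶠ_)
open import Data.Vec.Properties using (lookup∘tabulate; tabulate∘lookup; tabulate-cong; []=⇒lookup; lookup⇒[]=)
open import Function using (id; _∘_; case_of_)
open import Function.Bundles using (_⇔_; mk⇔; Equivalence; Inverse)
open import Function.Construct.Composition using (_⇔-∘_)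
open import Function.Definitions using (Injective)
open import Function.Properties.Inverse using (↔⇒⇔)
open import Induction.WellFounded using (Acc; acc)
open import Relation.Binary.PropositionalEquality using (_≡_; _≢_; refl; sym; trans; cong; subst; module ≡-Reasoning)
open import Relation.Nullary using (Dec; yes; no; ¬_)
open import Relation.Nullary.Decidable using (⌊_⌋; _×-dec_; ¬?; decidable-stable)

open Equivalence using (to; from)

∨≡true⇔ : ∀ {a b} → a ∨ b ≡ true ⇔ (a ≡ true ⊎ b ≡ true)
∨≡true⇔ {true} = mk⇔ (λ _ → inj₁ refl) (λ _ → refl)
∨≡true⇔ {false} = mk⇔ inj₂ [ (λ ()) , id ]

∧≡true⇔ : ∀ {a b} → a ∧ b ≡ true ⇔ (a ≡ true × b ≡ true)
∧≡true⇔ {true} = mk⇔ (refl ,_) proj₂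
∧≡true⇔ {false} = mk⇔ (λ ()) (λ ())

not≡true⇔ : ∀ {a} → not a ≡ true ⇔ a ≡ false
not≡true⇔ {true} = mk⇔ (λ ()) (λ ())
not≡true⇔ {false} = mk⇔ (λ _ → refl) (λ _ → refl)

⌊⌋≡true⇔ : ∀ {P : Set} (P? : Dec P) → ⌊ P? ⌋ ≡ true ⇔ P
⌊⌋≡true⇔ (yes p) = mk⇔ (λ _ → p) (λ _ → refl)
⌊⌋≡true⇔ (no ¬p) = mk⇔ (λ ()) (λ p → ⊥-elim (¬p p))

∈⇔lookup≡true : ∀ {n} {x : Fin n} {p : Subset n} → x ∈ p ⇔ lookup p x ≡ true
∈⇔lookup≡true {x = x} {p} = mk⇔ []=⇒lookup (lookup⇒[]= x p)

∈-tabulate⇔ : ∀ {n} (f : Fin n → Bool) {x} → x ∈ tabulate f ⇔ f x ≡ true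
∈-tabulate⇔ f {x} = mk⇔ (λ x∈ → trans (sym (lookup∘tabulate f x)) (to ∈⇔lookup≡true x∈))
                        (λ fx → from ∈⇔lookup≡true (trans (lookup∘tabulate f x) fx))

anyFin≡true⇔ : ∀ {k} (f : Fin k → Bool) → anyFin f ≡ true ⇔ (∃[ i ] f i ≡ true)
anyFin≡true⇔ {zero} f = mk⇔ (λ ()) (λ ())
anyFin≡true⇔ {suc k} f = mk⇔ to′ from′
  where
  to′ : anyFin f ≡ true → ∃[ i ] f i ≡ true
  to′ h with to ∨≡true⇔ h
  ... | inj₁ f0 = zero , f0
  ... | inj₂ rest with to (anyFin≡true⇔ (f ∘ suc)) rest
  ...   | i , fi = suc i , fi
  from′ : ∃[ i ] f i ≡ true → anyFin f ≡ true
  from′ (zero , f0) = from ∨≡true⇔ (inj₁ f0)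
  from′ (suc i , fi) = from (∨≡true⇔ {f zero}) (inj₂ (from (anyFin≡true⇔ (f ∘ suc)) (i , fi)))

∈-image⇔ : ∀ {k n} (φ : Fin k → Fin n) (X : Subset k) {y} →
           y ∈ image φ X ⇔ (∃[ x ] (x ∈ X × φ x ≡ y))
∈-image⇔ φ X {y} = mk⇔ to′ from′
  where
  to′ : y ∈ image φ X → ∃[ x ] (x ∈ X × φ x ≡ y)
  to′ y∈ with to (anyFin≡true⇔ _) (to (∈-tabulate⇔ _) y∈)
  ... | x , h with to ∧≡true⇔ h
  ...   | x∈X , φx≡y = x , from ∈⇔lookup≡true x∈X , to (⌊⌋≡true⇔ (φ x ≟ y)) φx≡y
  from′ : ∃[ x ] (x ∈ X × φ x ≡ y) → y ∈ image φ X
  from′ (x , x∈X , φx≡y) = from (∈-tabulate⇔ _) (from (anyFin≡true⇔ _)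
    (x , from ∧≡true⇔ (to ∈⇔lookup≡true x∈X , from (⌊⌋≡true⇔ (φ x ≟ y)) φx≡y)))

enumeration : ∀ {n} (S : Subset n) → Σ (Fin ∣ S ∣ → Fin n) λ c → Enumerates c S
enumeration [] = (λ ()) , (λ { {()} }) , λ ()
enumeration (outside ∷ S) with enumeration S
... | c , c-inj , c-enum = suc ∘ c , c-inj ∘ suc-injective , enum
  where
  enum : ∀ y → y ∈ outside ∷ S ⇔ (∃[ i ] suc (c i) ≡ y)
  enum zero = mk⇔ (λ ()) (λ ())
  enum (suc y) = mk⇔ (λ { (there y∈S) → map₂ (cong suc) (to (c-enum y) y∈S) })
                     (λ { (i , eq) → there (from (c-enum y) (i , suc-injective eq)) })
enumeration (inside ∷ S) with enumeration S
... | c , c-inj , c-enum = c′ , c′-inj , enum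
  where
  c′ : Fin (suc ∣ S ∣) → Fin _
  c′ zero = zero
  c′ (suc i) = suc (c i)
  c′-inj : Injective _≡_ _≡_ c′
  c′-inj {zero} {zero} _ = refl
  c′-inj {suc i} {suc j} eq = cong suc (c-inj (suc-injective eq))
  enum : ∀ y → y ∈ inside ∷ S ⇔ (∃[ i ] c′ i ≡ y)
  enum zero = mk⇔ (λ _ → zero , refl) (λ _ → here)
  enum (suc y) = mk⇔ (λ { (there y∈S) → map suc (cong suc) (to (c-enum y) y∈S) })
                     (λ { (suc i , eq) → there (from (c-enum y) (i , suc-injective eq)) })

enumerates-≤ : ∀ {k k′ n} {c : Fin k → Fin n} {c′ : Fin k′ → Fin n} {S : Subset n} →
               Enumerates c S → Enumerates c′ S → k ≤ k′
enumerates-≤ {c = c} {c′} (c-inj , c-enum) (_ , c′-enum) = injective⇒≤ preimage-inj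
  where
  preimage : ∀ i → ∃[ j ] c′ j ≡ c i
  preimage i = to (c′-enum (c i)) (from (c-enum (c i)) (i , refl))
  preimage-inj : Injective _≡_ _≡_ (proj₁ ∘ preimage)
  preimage-inj {i} {j} eq = c-inj (begin
    c i                     ≡⟨ sym (proj₂ (preimage i)) ⟩
    c′ (proj₁ (preimage i)) ≡⟨ cong c′ eq ⟩
    c′ (proj₁ (preimage j)) ≡⟨ proj₂ (preimage j) ⟩
    c j                     ∎)
    where open ≡-Reasoning

enumerates⇒≡∣∣ : ∀ {k n} {c : Fin k → Fin n} {S : Subset n} → Enumerates c S → k ≡ ∣ S ∣
enumerates⇒≡∣∣ {S = S} c-enum =
  ≤-antisym (enumerates-≤ c-enum (proj₂ (enumeration S))) (enumerates-≤ (proj₂ (enumeration S)) c-enum)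

id-enumerates-⊤ : ∀ {n} → Enumerates id (⊤ {n})
id-enumerates-⊤ = id , λ y → mk⇔ (λ _ → y , refl) (λ _ → ∈⊤)

image-enumerates : ∀ {k m n} {φ : Fin k → Fin n} {c : Fin m → Fin k} {X : Subset k} →
                   Injective _≡_ _≡_ φ → Enumerates c X → Enumerates (φ ∘ c) (image φ X)
image-enumerates {φ = φ} {c} {X} φ-inj (c-inj , c-enum) = c-inj ∘ φ-inj , enum
  where
  enum : ∀ y → y ∈ image φ X ⇔ (∃[ i ] φ (c i) ≡ y)
  enum y = mk⇔
    (λ y∈ → let x , x∈X , φx≡y = to (∈-image⇔ φ X) y∈ ; i , ci≡x = to (c-enum x) x∈X
            in i , trans (cong φ ci≡x) φx≡y)
    (λ { (i , eq) → from (∈-image⇔ φ X) (c i , from (c-enum (c i)) (i , refl) , eq) })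

∣image∣≡∣∣ : ∀ {k n} {φ : Fin k → Fin n} → Injective _≡_ _≡_ φ → (X : Subset k) → ∣ image φ X ∣ ≡ ∣ X ∣
∣image∣≡∣∣ φ-inj X = sym (enumerates⇒≡∣∣ (image-enumerates φ-inj (proj₂ (enumeration X))))

∣p∪q∣≤∣p∣+∣q∣ : ∀ {n} (p q : Subset n) → ∣ p ∪ q ∣ ≤ ∣ p ∣ + ∣ q ∣
∣p∪q∣≤∣p∣+∣q∣ [] [] = z≤n
∣p∪q∣≤∣p∣+∣q∣ (outside ∷ p) (outside ∷ q) = ∣p∪q∣≤∣p∣+∣q∣ p q
∣p∪q∣≤∣p∣+∣q∣ (outside ∷ p) (inside ∷ q) =
  ≤-trans (s≤s (∣p∪q∣≤∣p∣+∣q∣ p q)) (≤-reflexive (sym (+-suc ∣ p ∣ ∣ q ∣)))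
∣p∪q∣≤∣p∣+∣q∣ (inside ∷ p) (outside ∷ q) = s≤s (∣p∪q∣≤∣p∣+∣q∣ p q)
∣p∪q∣≤∣p∣+∣q∣ (inside ∷ p) (inside ∷ q) =
  s≤s (≤-trans (∣p∪q∣≤∣p∣+∣q∣ p q) (≤-trans (m≤n+m _ 1) (≤-reflexive (sym (+-suc ∣ p ∣ ∣ q ∣)))))

∣p∪⁅x⁆∣≤1+∣p∣ : ∀ {n} (p : Subset n) x → ∣ p ∪ ⁅ x ⁆ ∣ ≤ suc ∣ p ∣
∣p∪⁅x⁆∣≤1+∣p∣ p x = ≤-trans (∣p∪q∣≤∣p∣+∣q∣ p ⁅ x ⁆)
  (≤-reflexive (trans (cong (∣ p ∣ +_) (∣⁅x⁆∣≡1 x)) (+-comm ∣ p ∣ 1)))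

⊆-extend : ∀ {n m} (p : Subset n) → ∣ p ∣ ≤ m → m ≤ n → ∃[ q ] (p ⊆ q × ∣ q ∣ ≡ m)
⊆-extend [] z≤n z≤n = [] , id , refl
⊆-extend {suc n} {m} (s ∷ p) _ m≤1+n with m ≤? n
... | no m≰n = ⊤ , ⊆⊤ , trans (∣⊤∣≡n (suc n)) (≤-antisym (≰⇒> m≰n) m≤1+n)
⊆-extend (outside ∷ p) ∣p∣≤m _ | yes m≤n with ⊆-extend p ∣p∣≤m m≤n
... | q , p⊆q , ∣q∣≡m = outside ∷ q , s⊆s p⊆q , ∣q∣≡m
⊆-extend (inside ∷ p) (s≤s ∣p∣≤m) _ | yes m≤n with ⊆-extend p ∣p∣≤m (≤-trans (m≤n+m _ 1) m≤n)
... | q , p⊆q , ∣q∣≡m = inside ∷ q , s⊆s p⊆q , cong suc ∣q∣≡m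

p⊆q∧∣q∣≤∣p∣⇒q⊆p : ∀ {n} {p q : Subset n} → p ⊆ q → ∣ q ∣ ≤ ∣ p ∣ → q ⊆ p
p⊆q∧∣q∣≤∣p∣⇒q⊆p {p = p} {q} p⊆q ∣q∣≤∣p∣ {x} x∈q with x ∈? p
... | yes x∈p = x∈p
... | no x∉p = ⊥-elim (<⇒≱ (p⊂q⇒∣p∣<∣q∣ (p⊆q , x , x∈q , x∉p)) ∣q∣≤∣p∣)

∣p∣≡1+k⇒Nonempty : ∀ {n k} {p : Subset n} → ∣ p ∣ ≡ suc k → Nonempty p
∣p∣≡1+k⇒Nonempty {n} {p = p} ∣p∣≡1+k with nonempty? p
... | yes p-nonempty = p-nonempty
... | no p-empty with trans (sym (∣⊥∣≡0 n)) (trans (cong ∣_∣ (sym (Empty-unique p-empty))) ∣p∣≡1+k)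
...   | ()

x∈p─q⇒x∉q : ∀ {n} {x : Fin n} (p q : Subset n) → x ∈ p ─ q → x ∉ q
x∈p─q⇒x∉q (s ∷ p) (outside ∷ q) here ()
x∈p─q⇒x∉q (s ∷ p) (t ∷ q) (there x∈p─q) (there x∈q) = x∈p─q⇒x∉q p q x∈p─q x∈q

x∈p-y⇒x≢y : ∀ {n} {x y : Fin n} {p : Subset n} → x ∈ p - y → x ≢ y
x∈p-y⇒x≢y {y = y} {p} x∈p-y refl = x∈p─q⇒x∉q p ⁅ y ⁆ x∈p-y (x∈⁅x⁆ y)

x∉p-x : ∀ {n} {x : Fin n} {p : Subset n} → x ∉ p - x
x∉p-x x∈p-x = x∈p-y⇒x≢y x∈p-x refl

x∈p⇒x∈p-y⊎x≡y : ∀ {n} {x y : Fin n} {p : Subset n} → x ∈ p → x ∈ p - y ⊎ x ≡ y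
x∈p⇒x∈p-y⊎x≡y {x = x} {y} x∈p with x ≟ y
... | yes x≡y = inj₂ x≡y
... | no x≢y = inj₁ (x∈p∧x≢y⇒x∈p-y x∈p x≢y)

p⊆p-x∪⁅x⁆ : ∀ {n} (p : Subset n) x → p ⊆ (p - x) ∪ ⁅ x ⁆
p⊆p-x∪⁅x⁆ p x y∈p with x∈p⇒x∈p-y⊎x≡y y∈p
... | inj₁ y∈p-x = p⊆p∪q ⁅ x ⁆ y∈p-x
... | inj₂ refl = q⊆p∪q (p - x) ⁅ x ⁆ (x∈⁅x⁆ x)

[p∪⁅x⁆]-x≡p : ∀ {n} {p : Subset n} {x} → x ∉ p → (p ∪ ⁅ x ⁆) - x ≡ p
[p∪⁅x⁆]-x≡p {p = p} {x} x∉p = ⊆-antisym ⊆p ⊇p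
  where
  ⊆p : (p ∪ ⁅ x ⁆) - x ⊆ p
  ⊆p y∈ with x∈p∪q⁻ p ⁅ x ⁆ (p─q⊆p _ ⁅ x ⁆ y∈)
  ... | inj₁ y∈p = y∈p
  ... | inj₂ y∈⁅x⁆ = ⊥-elim (x∈p-y⇒x≢y y∈ (x∈⁅y⁆⇒x≡y x y∈⁅x⁆))
  ⊇p : p ⊆ (p ∪ ⁅ x ⁆) - x
  ⊇p y∈p = x∈p∧x≢y⇒x∈p-y (p⊆p∪q ⁅ x ⁆ y∈p) λ { refl → x∉p y∈p }

DownClosed : ∀ {n} → Family n → Set
DownClosed {n} G = ∀ (X Y : Subset n) → Y ⊆ X → X ∈H G → Y ∈H G

IsFlat : ∀ {n} → Family n → Subset n → Set
IsFlat {n} G F = ∀ (I : Subset n) p → I ∈H G → I ⊆ F → p ∉ F → I ∪ ⁅ p ⁆ ∈H G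

zeroSet : ∀ {m n} → BMatrix m n → Fin m → Subset n
zeroSet M i = tabulate (not ∘ M i)

∈-zeroSet⇔ : ∀ {m n} (M : BMatrix m n) i {x} → x ∈ zeroSet M i ⇔ M i x ≡ false
∈-zeroSet⇔ M i = not≡true⇔ ⇔-∘ ∈-tabulate⇔ (not ∘ M i)

∉-zeroSet⇒≡true : ∀ {m n} (M : BMatrix m n) i {x} → x ∉ zeroSet M i → M i x ≡ true
∉-zeroSet⇒≡true M i x∉Z = ¬-not (x∉Z ∘ from (∈-zeroSet⇔ M i))

RowsAreFlats : ∀ {m n} → BMatrix m n → Family n → Set
RowsAreFlats {m} M G = ∀ (i : Fin m) → IsFlat G (zeroSet M i)

injective-∷ᶠ : ∀ {A : Set} {k} {f : Fin k → A} {a : A} →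
               Injective _≡_ _≡_ f → (∀ j → f j ≢ a) → Injective _≡_ _≡_ (a ∷ᶠ f)
injective-∷ᶠ f-inj fresh {zero} {zero} _ = refl
injective-∷ᶠ f-inj fresh {zero} {suc j} a≡fj = ⊥-elim (fresh j (sym a≡fj))
injective-∷ᶠ f-inj fresh {suc i} {zero} fi≡a = ⊥-elim (fresh i fi≡a)
injective-∷ᶠ f-inj fresh {suc i} {suc j} fi≡fj = cong suc (f-inj fi≡fj)

witness-⊥ : ∀ {m n} (M : BMatrix m n) → HasLowerUnitriangularSubmatrix M ⊥
witness-⊥ M = 0 , (λ ()) , (λ ()) , (λ { {()} }) , ((λ { {()} }) , λ y → mk⇔ (⊥-elim ∘ ∉⊥) λ ()) ,
              (λ ()) , λ ()

witness-extend : ∀ {m n} {M : BMatrix m n} {X : Subset n} {x} (i : Fin m) →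
  x ∈ X → X - x ⊆ zeroSet M i → x ∉ zeroSet M i →
  HasLowerUnitriangularSubmatrix M (X - x) → HasLowerUnitriangularSubmatrix M X
witness-extend {M = M} {X} {x} i x∈X X-x⊆Z x∉Z (k , r , c , r-inj , (c-inj , c-enum) , diag , upper) =
  suc k , i ∷ᶠ r , x ∷ᶠ c , injective-∷ᶠ r-inj row-fresh , (injective-∷ᶠ c-inj col-fresh , enum) ,
  diag′ , upper′
  where
  c∈X-x : ∀ j → c j ∈ X - x
  c∈X-x j = from (c-enum (c j)) (j , refl)
  below : ∀ j → M i (c j) ≡ false
  below j = to (∈-zeroSet⇔ M i) (X-x⊆Z (c∈X-x j))
  row-fresh : ∀ j → r j ≢ i
  row-fresh j refl with trans (sym (diag j)) (below j)
  ... | ()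
  col-fresh : ∀ j → c j ≢ x
  col-fresh j = x∈p-y⇒x≢y (c∈X-x j)
  enum : ∀ y → y ∈ X ⇔ (∃[ j ] (x ∷ᶠ c) j ≡ y)
  enum y = mk⇔ to′ from′
    where
    to′ : y ∈ X → ∃[ j ] (x ∷ᶠ c) j ≡ y
    to′ y∈X with x∈p⇒x∈p-y⊎x≡y y∈X
    ... | inj₁ y∈X-x = map suc id (to (c-enum y) y∈X-x)
    ... | inj₂ refl = zero , refl
    from′ : ∃[ j ] (x ∷ᶠ c) j ≡ y → y ∈ X
    from′ (zero , refl) = x∈X
    from′ (suc j , cj≡y) = p─q⊆p X ⁅ x ⁆ (from (c-enum y) (j , cj≡y))
  diag′ : ∀ j → M ((i ∷ᶠ r) j) ((x ∷ᶠ c) j) ≡ true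
  diag′ zero = ∉-zeroSet⇒≡true M i x∉Z
  diag′ (suc j) = diag j
  upper′ : ∀ j j′ → j < j′ → M ((i ∷ᶠ r) j) ((x ∷ᶠ c) j′) ≡ false
  upper′ zero (suc j′) _ = below j′
  upper′ (suc j) (suc j′) (s≤s j<j′) = upper j j′ j<j′

witness-peel : ∀ {m n} {M : BMatrix m n} {X : Subset n} → Nonempty X →
  HasLowerUnitriangularSubmatrix M X →
  ∃[ i ] ∃[ x ] (x ∈ X × X - x ⊆ zeroSet M i × x ∉ zeroSet M i × HasLowerUnitriangularSubmatrix M (X - x))
witness-peel (y , y∈X) (zero , _ , _ , _ , (_ , c-enum) , _) = ⊥-elim (¬Fin0 (proj₁ (to (c-enum _) y∈X)))
witness-peel {M = M} {X} _ (suc k , r , c , r-inj , (c-inj , c-enum) , diag , upper) =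
  r zero , x , x∈X , X-x⊆Z , x∉Z ,
  (k , r ∘ suc , c ∘ suc , suc-injective ∘ r-inj , (suc-injective ∘ c-inj , enum) , diag ∘ suc ,
   λ j j′ j<j′ → upper (suc j) (suc j′) (s≤s j<j′))
  where
  x = c zero
  x∈X : x ∈ X
  x∈X = from (c-enum x) (zero , refl)
  enum : ∀ y → y ∈ X - x ⇔ (∃[ j ] c (suc j) ≡ y)
  enum y = mk⇔ to′ from′
    where
    to′ : y ∈ X - x → ∃[ j ] c (suc j) ≡ y
    to′ y∈X-x with to (c-enum y) (p─q⊆p X ⁅ x ⁆ y∈X-x)
    ... | zero , refl = ⊥-elim (x∈p-y⇒x≢y y∈X-x refl)
    ... | suc j , cj≡y = j , cj≡y
    from′ : ∃[ j ] c (suc j) ≡ y → y ∈ X - x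
    from′ (j , refl) = x∈p∧x≢y⇒x∈p-y (from (c-enum _) (suc j , refl)) (λ eq → case c-inj eq of λ ())
  X-x⊆Z : X - x ⊆ zeroSet M (r zero)
  X-x⊆Z y∈X-x with to (enum _) y∈X-x
  ... | j , refl = from (∈-zeroSet⇔ M (r zero)) (upper zero (suc j) (s≤s z≤n))
  x∉Z : x ∉ zeroSet M (r zero)
  x∉Z x∈Z with trans (sym (diag zero)) (to (∈-zeroSet⇔ M (r zero)) x∈Z)
  ... | ()

witness⇒∈ : ∀ {m n} {M : BMatrix m n} {G : Family n} → RowsAreFlats M G → DownClosed G → ⊥ ∈H G →
            ∀ X → HasLowerUnitriangularSubmatrix M X → X ∈H G
witness⇒∈ {M = M} {G} rows down ⊥∈G X = go X (⊂-wellFounded X)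
  where
  go : ∀ X → Acc _⊂_ X → HasLowerUnitriangularSubmatrix M X → X ∈H G
  go X (acc smaller) witness with nonempty? X
  ... | no X-empty = subst (_∈H G) (sym (Empty-unique X-empty)) ⊥∈G
  ... | yes X-nonempty with witness-peel X-nonempty witness
  ...   | i , x , x∈X , X-x⊆Z , x∉Z , witness′ =
    down ((X - x) ∪ ⁅ x ⁆) X (p⊆p-x∪⁅x⁆ X x)
      (rows i (X - x) x (go (X - x) (smaller (x∈p⇒p-x⊂p x∈X)) witness′) X-x⊆Z x∉Z)

representing⇒rowsAreFlats : ∀ {m n} {M : BMatrix m n} {G : Family n} →
  (∀ X → X ∈H G ⇔ HasLowerUnitriangularSubmatrix M X) → RowsAreFlats M G
representing⇒rowsAreFlats {M = M} rep i I p I∈G I⊆Z p∉Z =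
  from (rep _) (witness-extend i (q⊆p∪q I ⁅ p ⁆ (x∈⁅x⁆ p))
    (subst (_⊆ zeroSet M i) (sym I+p-p≡I) I⊆Z) p∉Z
    (subst (HasLowerUnitriangularSubmatrix M) (sym I+p-p≡I) (to (rep I) I∈G)))
  where
  I+p-p≡I : (I ∪ ⁅ p ⁆) - p ≡ I
  I+p-p≡I = [p∪⁅x⁆]-x≡p (λ p∈I → p∉Z (I⊆Z p∈I))

_∈H?_ : ∀ {n} (X : Subset n) (G : Family n) → Dec (X ∈H G)
X ∈H? G = G X ≟ᵇ true

isFlat? : ∀ {n} (G : Family n) (F : Subset n) → Dec (IsFlat G F)
isFlat? G F with anySubset? (λ I → any? (λ p →
  (I ∈H? G) ×-dec (I ⊆? F) ×-dec ¬? (p ∈? F) ×-dec ¬? ((I ∪ ⁅ p ⁆) ∈H? G)))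
... | yes (I , p , I∈G , I⊆F , p∉F , I+p∉G) = no λ F-flat → I+p∉G (F-flat I p I∈G I⊆F p∉F)
... | no no-violation = yes λ I p I∈G I⊆F p∉F → decidable-stable ((I ∪ ⁅ p ⁆) ∈H? G)
  λ I+p∉G → no-violation (I , p , I∈G , I⊆F , p∉F , I+p∉G)

⊤-isFlat : ∀ {n} (G : Family n) → IsFlat G ⊤
⊤-isFlat G I p _ _ p∉⊤ = ⊥-elim (p∉⊤ ∈⊤)

indexOf : ∀ {n} → Subset n → Fin (2 ^ n)
indexOf F = funToFin (Inverse.from 2↔Bool ∘ lookup F)

subsetAt : ∀ {n} → Fin (2 ^ n) → Subset n
subsetAt k = tabulate (Inverse.to 2↔Bool ∘ finToFun k)

subsetAt-indexOf : ∀ {n} (F : Subset n) → subsetAt (indexOf F) ≡ F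
subsetAt-indexOf F = begin
  tabulate (Inverse.to 2↔Bool ∘ finToFun (indexOf F)) ≡⟨ tabulate-cong (λ v →
    trans (cong (Inverse.to 2↔Bool) (finToFun-funToFin _ v)) (Inverse.strictlyInverseˡ 2↔Bool _)) ⟩
  tabulate (lookup F)                                 ≡⟨ tabulate∘lookup F ⟩
  F                                                   ∎
  where open ≡-Reasoning

SeparatedByFlat : ∀ {n} → Family n → Subset n → Fin n → Set
SeparatedByFlat G X x = ∃[ F ] (IsFlat G F × X - x ⊆ F × x ∉ F)

HasSeparatingFlats : ∀ {n} → Family n → Set
HasSeparatingFlats {n} G =
  ∀ (X : Subset n) → X ∈H G → Nonempty X → ∃[ x ] (x ∈ X × SeparatedByFlat G X x)

module _ {n} (G : Family n) where

  -- Indices of non-flats are sent to the flat ⊤, which only adds a zero row to flatMatrix.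
  flatAt : Fin (2 ^ n) → Subset n
  flatAt k with isFlat? G (subsetAt k)
  ... | yes _ = subsetAt k
  ... | no _ = ⊤

  flatAt-isFlat : ∀ k → IsFlat G (flatAt k)
  flatAt-isFlat k with isFlat? G (subsetAt k)
  ... | yes F-flat = F-flat
  ... | no _ = ⊤-isFlat G

  flatAt-indexOf : ∀ {F} → IsFlat G F → flatAt (indexOf F) ≡ F
  flatAt-indexOf {F} F-flat with isFlat? G (subsetAt (indexOf F))
  ... | yes _ = subsetAt-indexOf F
  ... | no ¬flat = ⊥-elim (¬flat (subst (IsFlat G) (sym (subsetAt-indexOf F)) F-flat))

  flatMatrix : BMatrix (2 ^ n) n
  flatMatrix k v = not (lookup (flatAt k) v)

  zeroSet-flatMatrix : ∀ k → zeroSet flatMatrix k ≡ flatAt k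
  zeroSet-flatMatrix k = trans (tabulate-cong (λ v → not-involutive _)) (tabulate∘lookup (flatAt k))

  flatMatrix-rowsAreFlats : RowsAreFlats flatMatrix G
  flatMatrix-rowsAreFlats k = subst (IsFlat G) (sym (zeroSet-flatMatrix k)) (flatAt-isFlat k)

  separated⇒witness : DownClosed G → HasSeparatingFlats G →
                      ∀ X → X ∈H G → HasLowerUnitriangularSubmatrix flatMatrix X
  separated⇒witness down separating X = go X (⊂-wellFounded X)
    where
    go : ∀ X → Acc _⊂_ X → X ∈H G → HasLowerUnitriangularSubmatrix flatMatrix X
    go X (acc smaller) X∈G with nonempty? X
    ... | no X-empty = subst (HasLowerUnitriangularSubmatrix flatMatrix) (sym (Empty-unique X-empty))
                             (witness-⊥ flatMatrix)
    ... | yes X-nonempty with separating X X∈G X-nonempty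
    ...   | x , x∈X , F , F-flat , X-x⊆F , x∉F =
      witness-extend {M = flatMatrix} (indexOf F) x∈X
        (subst (X - x ⊆_) (sym Z≡F) X-x⊆F) (subst (x ∉_) (sym Z≡F) x∉F)
        (go (X - x) (smaller (x∈p⇒p-x⊂p x∈X)) (down X (X - x) (p─q⊆p X ⁅ x ⁆) X∈G))
      where
      Z≡F : zeroSet flatMatrix (indexOf F) ≡ F
      Z≡F = trans (zeroSet-flatMatrix (indexOf F)) (flatAt-indexOf F-flat)

  separatingFlats⇒isBooleanRepresentable :
    DownClosed G → ⊥ ∈H G → HasSeparatingFlats G → IsBooleanRepresentable G
  separatingFlats⇒isBooleanRepresentable down ⊥∈G separating = 2 ^ n , flatMatrix , λ X →
    mk⇔ (separated⇒witness down separating X) (witness⇒∈ flatMatrix-rowsAreFlats down ⊥∈G X)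

module _ {n d : ℕ} (d≤n : d ≤ n) {G : Family n} (down : DownClosed G) (paving : IsPaving d G) where

  small⇒∈ : ∀ {X} → ∣ X ∣ ≤ d → X ∈H G
  small⇒∈ {X} ∣X∣≤d with ⊆-extend X ∣X∣≤d d≤n
  ... | Y , X⊆Y , ∣Y∣≡d = down Y X X⊆Y (paving Y ∣Y∣≡d)

  small⇒isFlat : ∀ {D} → suc ∣ D ∣ ≤ d → IsFlat G D
  small⇒isFlat ∣D∣<d I p _ I⊆D _ =
    small⇒∈ (≤-trans (∣p∪⁅x⁆∣≤1+∣p∣ I p) (≤-trans (s≤s (p⊆q⇒∣p∣≤∣q∣ I⊆D)) ∣D∣<d))

  uniformRestriction⇒subfamily : ∀ {H : Family n} {k} → (∀ {X} → X ∈H G → X ∈H H) →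
    HasUniformRestriction H d k → HasUniformRestriction G d k
  uniformRestriction⇒subfamily G⊆H (W , w , φ , φ-enum@(φ-inj , _) , uniform) =
    W , w , φ , φ-enum , λ X → mk⇔
      (λ ∣X∣≤d → small⇒∈ (≤-trans (≤-reflexive (∣image∣≡∣∣ φ-inj X)) ∣X∣≤d))
      (λ φX∈G → from (uniform X) (G⊆H φX∈G))

  large-flat⇒uniformRestriction : (∀ I → I ∈H G → ∣ I ∣ ≤ suc d) →
    ∀ {Z q} → IsFlat G Z → q ∉ Z → d + 2 ≤ ∣ Z ∣ → HasUniformRestriction G d (d + 2)
  large-flat⇒uniformRestriction bounded {Z} {q} Z-flat q∉Z d+2≤∣Z∣ =
    image φ ⊤ , (φ w , from (∈-image⇔ φ ⊤) (w , ∈⊤ , refl)) , φ ,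
    image-enumerates φ-inj id-enumerates-⊤ , uniform
    where
    e : Fin ∣ Z ∣ → Fin n
    e = proj₁ (enumeration Z)
    φ : Fin (d + 2) → Fin n
    φ i = e (inject≤ i d+2≤∣Z∣)
    φ-inj : Injective _≡_ _≡_ φ
    φ-inj = inject≤-injective _ _ _ _ ∘ proj₁ (proj₂ (enumeration Z))
    w : Fin (d + 2)
    w = fromℕ< (m<m+n d (s≤s z≤n))
    φ⊆Z : ∀ X → image φ X ⊆ Z
    φ⊆Z X y∈φX with to (∈-image⇔ φ X) y∈φX
    ... | x , _ , refl = from (proj₂ (proj₂ (enumeration Z)) (φ x)) (inject≤ x d+2≤∣Z∣ , refl)
    independent⇒small : ∀ X → image φ X ∈H G → ∣ X ∣ ≤ d
    independent⇒small X φX∈G with ∣ X ∣ ≤? d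
    ... | yes ∣X∣≤d = ∣X∣≤d
    ... | no ∣X∣≰d = ⊥-elim (<⇒≱ (begin-strict
      suc d                 ≤⟨ ≰⇒> ∣X∣≰d ⟩
      ∣ X ∣                 ≡⟨ ∣image∣≡∣∣ φ-inj X ⟨
      ∣ image φ X ∣         <⟨ p⊂q⇒∣p∣<∣q∣ (p⊆p∪q ⁅ q ⁆ , q , q⊆p∪q _ ⁅ q ⁆ (x∈⁅x⁆ q) , q∉Z ∘ φ⊆Z X) ⟩
      ∣ image φ X ∪ ⁅ q ⁆ ∣ ∎) (bounded _ (Z-flat (image φ X) q φX∈G (φ⊆Z X) q∉Z)))
      where open ≤-Reasoning
    uniform : ∀ X → ∣ X ∣ ≤ d ⇔ image φ X ∈H G
    uniform X = mk⇔ (λ ∣X∣≤d → small⇒∈ (≤-trans (≤-reflexive (∣image∣≡∣∣ φ-inj X)) ∣X∣≤d))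
                    (independent⇒small X)

module _ {n d m : ℕ} {Ha Hb H : Family n} {Ma : BMatrix m n} (d≤n : d ≤ n)
         (down-a : DownClosed Ha) (paving-a : IsPaving d Ha) (bounded-a : ∀ I → I ∈H Ha → ∣ I ∣ ≤ suc d)
         (representation-a : ∀ X → X ∈H Ha ⇔ HasLowerUnitriangularSubmatrix Ma X)
         (no-uniform-a : ¬ HasUniformRestriction Ha d (d + 2))
         (down-b : DownClosed Hb) (H⇔ : ∀ X → X ∈H H ⇔ (X ∈H Ha ⊎ X ∈H Hb)) where

  private
    Ha⊆H : ∀ {Y} → Y ∈H Ha → Y ∈H H
    Ha⊆H = from (H⇔ _) ∘ inj₁

  proper-flat⇒∣∣≤1+d : ∀ {Z q} → IsFlat Ha Z → q ∉ Z → ∣ Z ∣ ≤ suc d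
  proper-flat⇒∣∣≤1+d {Z} Z-flat q∉Z with ∣ Z ∣ ≤? suc d
  ... | yes ∣Z∣≤1+d = ∣Z∣≤1+d
  ... | no ∣Z∣≰1+d = ⊥-elim (no-uniform-a (large-flat⇒uniformRestriction d≤n down-a paving-a bounded-a
          Z-flat q∉Z (≤-trans (≤-reflexive (+-comm d 2)) (≰⇒> ∣Z∣≰1+d))))

  below-Hb-face⇒isFlat : ∀ {D Z} → ∣ D ∣ ≤ d → IsFlat Ha Z → D ⊆ Z → Z ∈H Hb → IsFlat H D
  below-Hb-face⇒isFlat {D} {Z} ∣D∣≤d Z-flat D⊆Z Z∈Hb J p _ J⊆D _ with p ∈? Z
  ... | yes p∈Z = from (H⇔ _) (inj₂ (down-b Z (J ∪ ⁅ p ⁆) J+p⊆Z Z∈Hb))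
    where
    J+p⊆Z : J ∪ ⁅ p ⁆ ⊆ Z
    J+p⊆Z y∈J+p with x∈p∪q⁻ J ⁅ p ⁆ y∈J+p
    ... | inj₁ y∈J = D⊆Z (J⊆D y∈J)
    ... | inj₂ y∈⁅p⁆ = subst (_∈ Z) (sym (x∈⁅y⁆⇒x≡y p y∈⁅p⁆)) p∈Z
  ... | no p∉Z = Ha⊆H (Z-flat J p (small⇒∈ d≤n down-a paving-a (≤-trans (p⊆q⇒∣p∣≤∣q∣ J⊆D) ∣D∣≤d))
                               (D⊆Z ∘ J⊆D) p∉Z)

  non-Hb-flat⇒isFlat : ∀ {Z} → IsFlat Ha Z → ∣ Z ∣ ≤ suc d → ¬ Z ∈H Hb → IsFlat H Z
  non-Hb-flat⇒isFlat {Z} Z-flat ∣Z∣≤1+d Z∉Hb K q K∈H K⊆Z q∉Z = Ha⊆H (Z-flat K q K∈Ha K⊆Z q∉Z)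
    where
    K∈Ha : K ∈H Ha
    K∈Ha with to (H⇔ K) K∈H
    ... | inj₁ K∈Ha = K∈Ha
    ... | inj₂ K∈Hb with ∣ K ∣ ≤? d
    ...   | yes ∣K∣≤d = small⇒∈ d≤n down-a paving-a ∣K∣≤d
    ...   | no ∣K∣≰d = ⊥-elim (Z∉Hb (down-b K Z Z⊆K K∈Hb))
      where
      Z⊆K : Z ⊆ K
      Z⊆K = p⊆q∧∣q∣≤∣p∣⇒q⊆p K⊆Z (≤-trans ∣Z∣≤1+d (≰⇒> ∣K∣≰d))

  facet-separatedByFlat : ∀ X → X ∈H Ha → ∣ X ∣ ≡ suc d → ∃[ x ] (x ∈ X × SeparatedByFlat H X x)
  facet-separatedByFlat X X∈Ha ∣X∣≡1+d
    with witness-peel (∣p∣≡1+k⇒Nonempty ∣X∣≡1+d) (to (representation-a X) X∈Ha)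
  ... | i , x , x∈X , X-x⊆Z , x∉Z , _ = x , x∈X , separating
    where
    Z-flat : IsFlat Ha (zeroSet Ma i)
    Z-flat = representing⇒rowsAreFlats representation-a i
    ∣X-x∣≤d : ∣ X - x ∣ ≤ d
    ∣X-x∣≤d = ≤-pred (≤-trans (x∈p⇒∣p-x∣<∣p∣ x∈X) (≤-reflexive ∣X∣≡1+d))
    separating : SeparatedByFlat H X x
    separating with zeroSet Ma i ∈H? Hb
    ... | yes Z∈Hb = X - x , below-Hb-face⇒isFlat ∣X-x∣≤d Z-flat X-x⊆Z Z∈Hb , id , x∉p-x
    ... | no Z∉Hb = zeroSet Ma i , non-Hb-flat⇒isFlat Z-flat (proper-flat⇒∣∣≤1+d Z-flat x∉Z) Z∉Hb ,
                    X-x⊆Z , x∉Z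

hasDimension⇒⊥∈ : ∀ {n d} {G : Family n} → DownClosed G → HasDimension d G → ⊥ ∈H G
hasDimension⇒⊥∈ down ((I , I∈G , _) , _) = down I ⊥ ⊥⊆ I∈G

module _ {n : ℕ} {H₁ H₂ : Family n} where

  ∈-∪H⇔ : ∀ {X} → X ∈H H₁ ∪H H₂ ⇔ (X ∈H H₁ ⊎ X ∈H H₂)
  ∈-∪H⇔ = ∨≡true⇔

  ∈-∪Hˡ : ∀ {X} → X ∈H H₁ → X ∈H H₁ ∪H H₂
  ∈-∪Hˡ = from ∈-∪H⇔ ∘ inj₁

  ∪H-downClosed : DownClosed H₁ → DownClosed H₂ → DownClosed (H₁ ∪H H₂)
  ∪H-downClosed down₁ down₂ X Y Y⊆X X∈H with to ∈-∪H⇔ X∈H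
  ... | inj₁ X∈H₁ = from ∈-∪H⇔ (inj₁ (down₁ X Y Y⊆X X∈H₁))
  ... | inj₂ X∈H₂ = from ∈-∪H⇔ (inj₂ (down₂ X Y Y⊆X X∈H₂))

  ∪H-isSimplicialComplex : IsSimplicialComplex H₁ → IsSimplicialComplex H₂ → IsSimplicialComplex (H₁ ∪H H₂)
  ∪H-isSimplicialComplex (singletons₁ , down₁) (_ , down₂) =
    (λ i → ∈-∪Hˡ (singletons₁ i)) , ∪H-downClosed down₁ down₂

  ∪H-hasDimension : ∀ {d} → HasDimension d H₁ → HasDimension d H₂ → HasDimension d (H₁ ∪H H₂)
  ∪H-hasDimension ((I , I∈H₁ , ∣I∣≡1+d) , bounded₁) (_ , bounded₂) =
    (I , ∈-∪Hˡ I∈H₁ , ∣I∣≡1+d) , λ X X∈H → [ bounded₁ X , bounded₂ X ] (to ∈-∪H⇔ X∈H)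

  ∪H-isPaving : ∀ {d} → IsPaving d H₁ → IsPaving d (H₁ ∪H H₂)
  ∪H-isPaving paving₁ X ∣X∣≡d = ∈-∪Hˡ (paving₁ X ∣X∣≡d)

  ∪H-hasSeparatingFlats : ∀ {d} → d ≤ n → InY d H₁ → InY d H₂ → HasSeparatingFlats (H₁ ∪H H₂)
  ∪H-hasSeparatingFlats {d} d≤n
    (((_ , down₁) , (_ , bounded₁) , paving₁ , (_ , M₁ , representation₁)) , no-uniform₁)
    (((_ , down₂) , (_ , bounded₂) , paving₂ , (_ , M₂ , representation₂)) , no-uniform₂)
    X X∈H (x , x∈X) with ∣ X ∣ ≤? d
  ... | yes ∣X∣≤d = x , x∈X , X - x ,
    small⇒isFlat d≤n (∪H-downClosed down₁ down₂) (∪H-isPaving paving₁) (≤-trans (x∈p⇒∣p-x∣<∣p∣ x∈X) ∣X∣≤d) ,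
    id , x∉p-x
  ... | no ∣X∣≰d with to ∈-∪H⇔ X∈H
  ...   | inj₁ X∈H₁ = facet-separatedByFlat {Ma = M₁} d≤n down₁ paving₁ bounded₁ representation₁
                        no-uniform₁ down₂ (λ _ → ∈-∪H⇔) X X∈H₁ (≤-antisym (bounded₁ X X∈H₁) (≰⇒> ∣X∣≰d))
  ...   | inj₂ X∈H₂ = facet-separatedByFlat {Ma = M₂} d≤n down₂ paving₂ bounded₂ representation₂
                        no-uniform₂ down₁ (λ _ → ↔⇒⇔ (⊎-comm _ _) ⇔-∘ ∈-∪H⇔) X X∈H₂ (≤-antisym (bounded₂ X X∈H₂) (≰⇒> ∣X∣≰d))

proposition5p10 : (d n : ℕ) → 2 ≤ d → d + 2 ≤ n →
    (H₁ H₂ : Family n) → InY d H₁ → InY d H₂ → InY d (H₁ ∪H H₂)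
proposition5p10 d n _ d+2≤n H₁ H₂ Y₁@((sc₁ , dim₁ , paving₁ , _) , no-uniform₁) Y₂@((sc₂ , dim₂ , _) , _) =
  (sc , dim , ∪H-isPaving paving₁ ,
   separatingFlats⇒isBooleanRepresentable (H₁ ∪H H₂) (proj₂ sc) (hasDimension⇒⊥∈ (proj₂ sc) dim)
     (∪H-hasSeparatingFlats d≤n Y₁ Y₂)) ,
  λ U → no-uniform₁ (uniformRestriction⇒subfamily d≤n (proj₂ sc₁) paving₁ (∈-∪Hˡ {H₁ = H₁} {H₂}) U)
  where
  d≤n : d ≤ n
  d≤n = ≤-trans (m≤m+n d 2) d+2≤n
  sc : IsSimplicialComplex (H₁ ∪H H₂)
  sc = ∪H-isSimplicialComplex sc₁ sc₂
  dim : HasDimension d (H₁ ∪H H₂)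
  dim = ∪H-hasDimension dim₁ dim₂
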